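{- Let $b,h,h^+\in\omega^\omega$. Assume $\langle I_k\rangle_{k<\omega}$ is an interval partition of $\omega$ such that $h(i)\geq h^+(k)$ for all $k<\omega$ and $i\in I_k$, and define $b^+\in\omega^\omega$ by $b^+(k)=\prod_{i\in I_k}b(i)$. Then $\mathbf{LLc}(b,h)\preceq_T\mathbf{LLc}(b^+,h^+)$ and $\mathbf{ILc}(b,h)\preceq_T\mathbf{ILc}(b^+,h^+)$.
   Context: $\mathbf{R}\preceq_T\mathbf{R}'$ for relational systems $\mathbf{R}=\langle X,Y,\sqsubset\rangle$, $\mathbf{R}'=\langle X',Y',\sqsubset'\rangle$ means there are $\Phi_-:X\to X'$, $\Phi_+:Y'\to Y$ with $\Phi_-(x)\sqsubset' y'\Rightarrow x\sqsubset\Phi_+(y')$ for all $x\in X$, $y'\in Y'$. For $b,h\in\omega^\omega$: $\prod b=\prod_n b(n)$, $\mathcal{S}(b,h)=\prod_n[b(n)]^{\leq h(n)}$ (a natural number $m$ is identified with $\{0,\dots,m-1\}$). For $x\in\prod b$, $\varphi\in\mathcal{S}(b,h)$, $D\in[\omega]^\omega$: $x\in^\infty\varphi$ iff $x(n)\in\varphi(n)$ for infinitely many $n$; $x\in^*_D\varphi$ iff $x(n)\in\varphi(n)$ for all but finitely many $n\in D$. $\mathbf{ILc}(b,h)=\langle\prod b,\mathcal{S}(b,h),\in^\infty\rangle$ and $\mathbf{LLc}(b,h)=\langle\prod b,[\omega]^\omega\times\mathcal{S}(b,h),\sqsubset\rangle$ with $x\sqsubset(D,\varphi)$ iff $x\in^*_D\varphi$.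 -}

module Defs where

open import Data.Nat using (ℕ; zero; suc; _+_; _*_; _∸_; _≤_; _<_)
open import Data.Bool using (Bool; true)
open import Data.Fin using (Fin)
open import Data.Fin.Subset using (Subset; _∈_; ∣_∣)
open import Data.Product using (Σ; ∃; _×_; _,_)
open import Relation.Binary.PropositionalEquality using (_≡_)

record RelSys : Set₁ where
  constructor ⟨_,_,_⟩
  field
    X : Set
    Y : Set
    rel : X → Y → Set

_⪯T_ : RelSys → RelSys → Set
R ⪯T R' =
  Σ (RelSys.X R → RelSys.X R') λ Φ₋ →
  Σ (RelSys.Y R' → RelSys.Y R) λ Φ₊ →
    ∀ (x : RelSys.X R) (y' : RelSys.Y R') →
      RelSys.rel R' (Φ₋ x) y' → RelSys.rel R x (Φ₊ y')

Prod : (ℕ → ℕ) → Set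
Prod b = (n : ℕ) → Fin (b n)

Slalom : (ℕ → ℕ) → (ℕ → ℕ) → Set
Slalom b h = Σ ((n : ℕ) → Subset (b n)) λ φ → (n : ℕ) → ∣ φ n ∣ ≤ h n

InfSet : Set
InfSet = Σ (ℕ → Bool) λ D → (m : ℕ) → ∃ λ n → m ≤ n × D n ≡ true

_∈∞_ : {b h : ℕ → ℕ} → Prod b → Slalom b h → Set
x ∈∞ (φ , _) = (m : ℕ) → ∃ λ n → m ≤ n × x n ∈ φ n

_∈*[_]_ : {b h : ℕ → ℕ} → Prod b → InfSet → Slalom b h → Set
x ∈*[ (D , _) ] (φ , _) = ∃ λ m → (n : ℕ) → m ≤ n → D n ≡ true → x n ∈ φ n

ILc : (ℕ → ℕ) → (ℕ → ℕ) → RelSys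
ILc b h = ⟨ Prod b , Slalom b h , (λ x φ → x ∈∞ φ) ⟩

LLc : (ℕ → ℕ) → (ℕ → ℕ) → RelSys
LLc b h = ⟨ Prod b , InfSet × Slalom b h , (λ { x (D , φ) → x ∈*[ D ] φ }) ⟩

-- Interval partition of ω given by endpoints e: I_k = [e k, e (k+1)),
-- with e 0 = 0 and e strictly increasing (intervals nonempty, finite).
IsIntervalPartition : (ℕ → ℕ) → Set
IsIntervalPartition e = (e 0 ≡ 0) × ((k : ℕ) → e k < e (suc k))

InInterval : (ℕ → ℕ) → ℕ → ℕ → Set
InInterval e k i = (e k ≤ i) × (i < e (suc k))

prodFrom : (ℕ → ℕ) → ℕ → ℕ → ℕ
prodFrom b s zero = 1
prodFrom b s (suc len) = b s * prodFrom b (suc s) len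

bPlus : (ℕ → ℕ) → (ℕ → ℕ) → ℕ → ℕ
bPlus b e k = prodFrom b (e k) (e (suc k) ∸ e k)

-- A point x ∈ ∏ b is sent to the sequence of its restrictions x ↾ I_k, each coded as a single
-- element of b⁺(k) = ∏_{i ∈ I_k} b(i) in mixed radix.  Conversely a slalom ψ for b⁺ is pulled
-- back to φ(i) = { c(i) | c ∈ ψ(k) } where I_k ∋ i, so |φ(i)| ≤ |ψ(k)| ≤ h⁺(k) ≤ h(i), and
-- x ↾ I_k ∈ ψ(k) gives x(i) ∈ φ(i) for every i ∈ I_k.  A hit at block k is thus a hit at e(k),
-- and "almost all k ∈ D" becomes "almost all i in the union of the blocks I_k, k ∈ D".
module Submission where

open import Defs
open import Data.Nat using (ℕ; zero; suc; _+_; _∸_; _≤_; _<_; _≮_; z≤n; s≤s; _≤?_; _≟_; _≤′_; ≤′-refl; ≤′-step)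
open import Data.Nat.Properties
open import Data.Bool using (true; false)
open import Data.Fin as F using (Fin; combine; remQuot)
open import Data.Fin.Properties using (remQuot-combine)
open import Data.Fin.Subset using (Subset; _∈_; ∣_∣; ⊥; ⁅_⁆; _∪_)
open import Data.Fin.Subset.Properties using (∣⊥∣≡0; ∣⁅x⁆∣≡1; x∈⁅x⁆; x∈p∪q⁺)
open import Data.Vec using ([]; _∷_; here; there)
open import Data.Product using (_×_; ∃; _,_; proj₁; proj₂)
open import Data.Sum using (inj₁; inj₂)
open import Data.Empty using (⊥-elim)
open import Relation.Nullary using (yes; no)
open import Relation.Binary.PropositionalEquality
open import Function using (_∘_)

∣p∪q∣≤∣p∣+∣q∣ : ∀ {n} (p q : Subset n) → ∣ p ∪ q ∣ ≤ ∣ p ∣ + ∣ q ∣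
∣p∪q∣≤∣p∣+∣q∣ []          []          = z≤n
∣p∪q∣≤∣p∣+∣q∣ (true ∷ p)  (true ∷ q)  = s≤s (≤-trans (∣p∪q∣≤∣p∣+∣q∣ p q) (+-monoʳ-≤ ∣ p ∣ (n≤1+n _)))
∣p∪q∣≤∣p∣+∣q∣ (true ∷ p)  (false ∷ q) = s≤s (∣p∪q∣≤∣p∣+∣q∣ p q)
∣p∪q∣≤∣p∣+∣q∣ (false ∷ p) (true ∷ q)  = ≤-trans (s≤s (∣p∪q∣≤∣p∣+∣q∣ p q)) (≤-reflexive (sym (+-suc ∣ p ∣ ∣ q ∣)))
∣p∪q∣≤∣p∣+∣q∣ (false ∷ p) (false ∷ q) = ∣p∪q∣≤∣p∣+∣q∣ p q

image : ∀ {m n} → (Fin m → Fin n) → Subset m → Subset n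
image f []          = ⊥
image f (true ∷ p)  = ⁅ f F.zero ⁆ ∪ image (f ∘ F.suc) p
image f (false ∷ p) = image (f ∘ F.suc) p

∣image∣≤∣p∣ : ∀ {m n} (f : Fin m → Fin n) (p : Subset m) → ∣ image f p ∣ ≤ ∣ p ∣
∣image∣≤∣p∣ {n = n} f [] = ≤-reflexive (∣⊥∣≡0 n)
∣image∣≤∣p∣ f (true ∷ p) = begin
  ∣ ⁅ f F.zero ⁆ ∪ image (f ∘ F.suc) p ∣       ≤⟨ ∣p∪q∣≤∣p∣+∣q∣ ⁅ f F.zero ⁆ _ ⟩
  ∣ ⁅ f F.zero ⁆ ∣ + ∣ image (f ∘ F.suc) p ∣   ≡⟨ cong (_+ ∣ image (f ∘ F.suc) p ∣) (∣⁅x⁆∣≡1 (f F.zero)) ⟩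
  suc ∣ image (f ∘ F.suc) p ∣                  ≤⟨ s≤s (∣image∣≤∣p∣ (f ∘ F.suc) p) ⟩
  suc ∣ p ∣                                    ∎
  where open ≤-Reasoning
∣image∣≤∣p∣ f (false ∷ p) = ∣image∣≤∣p∣ (f ∘ F.suc) p

x∈p⇒fx∈image : ∀ {m n} (f : Fin m → Fin n) {p : Subset m} {x : Fin m} → x ∈ p → f x ∈ image f p
x∈p⇒fx∈image f {true ∷ p}  here        = x∈p∪q⁺ (inj₁ (x∈⁅x⁆ (f F.zero)))
x∈p⇒fx∈image f {true ∷ p}  (there x∈p) = x∈p∪q⁺ (inj₂ (x∈p⇒fx∈image (f ∘ F.suc) x∈p))
x∈p⇒fx∈image f {false ∷ p} (there x∈p) = x∈p⇒fx∈image (f ∘ F.suc) x∈p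

module MixedRadix (b : ℕ → ℕ) where

  encode : (s len : ℕ) → Prod b → Fin (prodFrom b s len)
  encode s zero      x = F.zero
  encode s (suc len) x = combine (x s) (encode (suc s) len x)

  private
    empty-range : ∀ {s i} → s ≤ i → i ≮ s + 0
    empty-range {s} s≤i i<s+0 = <⇒≱ (subst (_ <_) (+-identityʳ s) i<s+0) s≤i

  coordinate : (s len : ℕ) {i : ℕ} → s ≤ i → i < s + len → Fin (prodFrom b s len) → Fin (b i)
  coordinate s zero      s≤i i<s+len c = ⊥-elim (empty-range s≤i i<s+len)
  coordinate s (suc len) {i} s≤i i<s+len c with s ≟ i
  ... | yes refl = proj₁ (remQuot {b s} _ c)
  ... | no s≢i   = coordinate (suc s) len (≤∧≢⇒< s≤i s≢i) (subst (i <_) (+-suc s len) i<s+len)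
                     (proj₂ (remQuot {b s} _ c))

  coordinate-encode : (x : Prod b) (s len : ℕ) {i : ℕ} (s≤i : s ≤ i) (i<s+len : i < s + len) →
                      coordinate s len s≤i i<s+len (encode s len x) ≡ x i
  coordinate-encode x s zero      s≤i i<s+len = ⊥-elim (empty-range s≤i i<s+len)
  coordinate-encode x s (suc len) {i} s≤i i<s+len with s ≟ i
  ... | yes refl = cong proj₁ (remQuot-combine {b s} (x s) (encode (suc s) len x))
  ... | no s≢i   = trans (cong (coordinate (suc s) len _ _) (cong proj₂ (remQuot-combine {b s} (x s) _)))
                         (coordinate-encode x (suc s) len _ _)

module IntervalPartition (e : ℕ → ℕ) (partition : IsIntervalPartition e) where

  e-increasing : ∀ k → e k < e (suc k)
  e-increasing = proj₂ partition

  e-mono : ∀ {k l} → k ≤ l → e k ≤ e l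
  e-mono = e-mono′ ∘ ≤⇒≤′
    where
    e-mono′ : ∀ {k l} → k ≤′ l → e k ≤ e l
    e-mono′ ≤′-refl         = ≤-refl
    e-mono′ (≤′-step k≤′l) = ≤-trans (e-mono′ k≤′l) (<⇒≤ (e-increasing _))

  k≤e[k] : ∀ k → k ≤ e k
  k≤e[k] zero    = z≤n
  k≤e[k] (suc k) = ≤-trans (s≤s (k≤e[k] k)) (e-increasing k)

  e[k]∈I[k] : ∀ k → InInterval e k (e k)
  e[k]∈I[k] k = ≤-refl , e-increasing k

  blockOf : ∀ i → ∃ λ k → InInterval e k i
  blockOf zero = 0 , ≤-reflexive (proj₁ partition) , subst (_< e 1) (proj₁ partition) (e-increasing 0)
  blockOf (suc i) with blockOf i
  ... | k , e[k]≤i , i<e[1+k] with e (suc k) ≤? suc i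
  ... | yes e[1+k]≤1+i = suc k , e[1+k]≤1+i ,
                          subst (_< e (suc (suc k))) (≤-antisym e[1+k]≤1+i i<e[1+k]) (e-increasing (suc k))
  ... | no  e[1+k]≰1+i = k , m≤n⇒m≤1+n e[k]≤i , ≰⇒> e[1+k]≰1+i

  block : ℕ → ℕ
  block i = proj₁ (blockOf i)

  i∈I[block[i]] : ∀ i → InInterval e (block i) i
  i∈I[block[i]] i = proj₂ (blockOf i)

  e[m]≤i⇒m≤k : ∀ {k i m} → InInterval e k i → e m ≤ i → m ≤ k
  e[m]≤i⇒m≤k (_ , i<e[1+k]) e[m]≤i = ≮⇒≥ λ k<m → <⇒≱ (<-≤-trans i<e[1+k] (e-mono k<m)) e[m]≤i

  inInterval-unique : ∀ {k l i} → InInterval e k i → InInterval e l i → k ≡ l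
  inInterval-unique i∈I[k] i∈I[l] =
    ≤-antisym (e[m]≤i⇒m≤k i∈I[l] (proj₁ i∈I[k])) (e[m]≤i⇒m≤k i∈I[k] (proj₁ i∈I[l]))

  blockLength : ℕ → ℕ
  blockLength k = e (suc k) ∸ e k

  i<e[k]+blockLength : ∀ {k i} → InInterval e k i → i < e k + blockLength k
  i<e[k]+blockLength {k} (_ , i<e[1+k]) =
    <-≤-trans i<e[1+k] (≤-reflexive (sym (m+[n∸m]≡n (<⇒≤ (e-increasing k)))))

  block-e : ∀ k → block (e k) ≡ k
  block-e k = inInterval-unique (i∈I[block[i]] (e k)) (e[k]∈I[k] k)

module BlockCoding (b e : ℕ → ℕ) (partition : IsIntervalPartition e) where
  open MixedRadix b
  open IntervalPartition e partition

  encodeBlocks : Prod b → Prod (bPlus b e)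
  encodeBlocks x k = encode (e k) (blockLength k) x

  coordinateInBlock : ∀ i → Fin (bPlus b e (block i)) → Fin (b i)
  coordinateInBlock i = coordinate (e (block i)) (blockLength (block i))
                          (proj₁ (i∈I[block[i]] i)) (i<e[k]+blockLength (i∈I[block[i]] i))

  coordinateInBlock-encodeBlocks : ∀ x i → coordinateInBlock i (encodeBlocks x (block i)) ≡ x i
  coordinateInBlock-encodeBlocks x i = coordinate-encode x (e (block i)) (blockLength (block i)) _ _

  pullback : ((k : ℕ) → Subset (bPlus b e k)) → (i : ℕ) → Subset (b i)
  pullback ψ i = image (coordinateInBlock i) (ψ (block i))

  pullback⁺ : ∀ {x} ψ i → encodeBlocks x (block i) ∈ ψ (block i) → x i ∈ pullback ψ i
  pullback⁺ {x} ψ i ∈ψ = subst (_∈ pullback ψ i) (coordinateInBlock-encodeBlocks x i)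
                               (x∈p⇒fx∈image (coordinateInBlock i) ∈ψ)

  pullbackSlalom : ∀ {h h⁺} → ((k i : ℕ) → InInterval e k i → h⁺ k ≤ h i) →
                   Slalom (bPlus b e) h⁺ → Slalom b h
  pullbackSlalom h⁺≤h (ψ , ∣ψ∣≤h⁺) = pullback ψ , λ i → begin
    ∣ pullback ψ i ∣   ≤⟨ ∣image∣≤∣p∣ (coordinateInBlock i) (ψ (block i)) ⟩
    ∣ ψ (block i) ∣    ≤⟨ ∣ψ∣≤h⁺ (block i) ⟩
    _                  ≤⟨ h⁺≤h (block i) i (i∈I[block[i]] i) ⟩
    _                  ∎
    where open ≤-Reasoning

  pullbackInfSet : InfSet → InfSet
  pullbackInfSet (D , D-infinite) = D ∘ block , λ m →
    let (k , m≤k , k∈D) = D-infinite m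
    in e k , ≤-trans m≤k (k≤e[k] k) , trans (cong D (block-e k)) k∈D

  ILc-⪯T : ∀ {h h⁺} → ((k i : ℕ) → InInterval e k i → h⁺ k ≤ h i) → ILc b h ⪯T ILc (bPlus b e) h⁺
  ILc-⪯T h⁺≤h = encodeBlocks , pullbackSlalom h⁺≤h , λ { x (ψ , _) hits m →
    let (k , m≤k , xk∈ψk) = hits m
    in e k , ≤-trans m≤k (k≤e[k] k) ,
       pullback⁺ ψ (e k) (subst (λ l → encodeBlocks x l ∈ ψ l) (sym (block-e k)) xk∈ψk) }

  LLc-⪯T : ∀ {h h⁺} → ((k i : ℕ) → InInterval e k i → h⁺ k ≤ h i) → LLc b h ⪯T LLc (bPlus b e) h⁺
  LLc-⪯T h⁺≤h = encodeBlocks , (λ { (D , φ) → pullbackInfSet D , pullbackSlalom h⁺≤h φ }) ,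
    λ { x (D , ψ , _) (m , caught) → e m , λ i e[m]≤i i∈D →
          pullback⁺ ψ i (caught (block i) (e[m]≤i⇒m≤k (i∈I[block[i]] i) e[m]≤i) i∈D) }

lemma2p5 : (b h h⁺ e : ℕ → ℕ) → IsIntervalPartition e →
    ((k i : ℕ) → InInterval e k i → h⁺ k ≤ h i) →
    (LLc b h ⪯T LLc (bPlus b e) h⁺) × (ILc b h ⪯T ILc (bPlus b e) h⁺)
lemma2p5 b h h⁺ e partition h⁺≤h = LLc-⪯T h⁺≤h , ILc-⪯T h⁺≤h
  where open BlockCoding b e partition
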